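{- In each of the logics DmBL and DmBL$_\ast$, for all $\phi,\psi\in\mathcal{L}$: $(\psi|\phi)\wedge\phi\equiv\phi\wedge\psi$.
   Context: Fix a set $\Theta$ of atomic propositions. The language $\mathcal{L}$ is the smallest set containing $\Theta$ and closed under the formation of $\neg\phi$, $\Box\phi$, $\phi\rightarrow\psi$ and the conditional $(\psi|\phi)$. Abbreviations: $\phi\vee\psi=\neg\phi\rightarrow\psi$, $\phi\wedge\psi=\neg(\neg\phi\vee\neg\psi)$, $\phi\leftrightarrow\psi=(\phi\rightarrow\psi)\wedge(\psi\rightarrow\phi)$, $\top=\theta_0\rightarrow\theta_0$ for a fixed $\theta_0\in\Theta$, $\bot=\neg\top$, $\Diamond\phi=\neg\Box\neg\phi$, and (logical independence) $\psi\times\phi=\Box\bigl((\psi|\phi)\leftrightarrow\psi\bigr)$. The theorems ($\vdash$) of DmBL are the smallest set containing all instances of the axiom schemes below and closed under modus ponens (from $\vdash\phi$ and $\vdash\phi\rightarrow\psi$ infer $\vdash\psi$) and necessitation m1 (from $\vdash\phi$ infer $\vdash\Box\phi$): c1 $\phi\rightarrow(\psi\rightarrow\phi)$; c2 $(\eta\rightarrow(\phi\rightarrow\psi))\rightarrow((\eta\rightarrow\phi)\rightarrow(\eta\rightarrow\psi))$; c3 $(\neg\phi\rightarrow\neg\psi)\rightarrow((\neg\phi\rightarrow\psi)\rightarrow\phi)$; m2 $\Box(\phi\rightarrow\psi)\rightarrow(\Box\phi\rightarrow\Box\psi)$; m3 $\Box\phi\rightarrow\phi$; b1 $\Box(\phi\rightarrow\psi)\rightarrow(\Box\neg\phi\vee\Box(\psi|\phi))$;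 b2 $((\psi\rightarrow\eta)|\phi)\rightarrow((\psi|\phi)\rightarrow(\eta|\phi))$; b3 $(\psi|\phi)\rightarrow(\phi\rightarrow\psi)$; b4 $\neg(\neg\psi|\phi)\leftrightarrow(\psi|\phi)$; b5 $(\psi\times\phi)\leftrightarrow(\phi\times\psi)$. The logic DmBL$_\ast$ is defined in the same way but with b5 replaced by the two schemes b5.weak.A $(\psi\times\neg\phi)\leftrightarrow(\psi\times\phi)$ and b5.weak.B $\Box(\psi\leftrightarrow\eta)\rightarrow\Box((\phi|\psi)\leftrightarrow(\phi|\eta))$. $\phi\equiv\psi$ means $\vdash\phi\leftrightarrow\psi$. -}

module Defs where

open import Level using (Level)

data Form {a : Level} (Θ : Set a) : Set a where
  atom : Θ → Form Θ
  ¬′_  : Form Θ → Form Θ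
  □_   : Form Θ → Form Θ
  _⇒_  : Form Θ → Form Θ → Form Θ
  _∣_  : Form Θ → Form Θ → Form Θ   -- (ψ ∣ φ) is the conditional (ψ|φ)

infixr 5 _⇒_
infix 8 ¬′_ □_

module Abbrev {a : Level} {Θ : Set a} (θ₀ : Θ) where
  _∨_ : Form Θ → Form Θ → Form Θ
  φ ∨ ψ = (¬′ φ) ⇒ ψ

  _∧_ : Form Θ → Form Θ → Form Θ
  φ ∧ ψ = ¬′ ((¬′ φ) ∨ (¬′ ψ))

  _⇔_ : Form Θ → Form Θ → Form Θ
  φ ⇔ ψ = (φ ⇒ ψ) ∧ (ψ ⇒ φ)

  ⊤′ : Form Θ
  ⊤′ = atom θ₀ ⇒ atom θ₀

  ⊥′ : Form Θ
  ⊥′ = ¬′ ⊤′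

  ◇_ : Form Θ → Form Θ
  ◇ φ = ¬′ (□ (¬′ φ))

  _⊗_ : Form Θ → Form Θ → Form Θ
  ψ ⊗ φ = □ ((ψ ∣ φ) ⇔ ψ)

data Logic : Set where
  DmBL DmBL* : Logic

module Proof {a : Level} {Θ : Set a} (θ₀ : Θ) where
  open Abbrev θ₀

  data _⊢_ : Logic → Form Θ → Set a where
    c1 : ∀ {L} φ ψ → L ⊢ (φ ⇒ (ψ ⇒ φ))
    c2 : ∀ {L} η φ ψ → L ⊢ ((η ⇒ (φ ⇒ ψ)) ⇒ ((η ⇒ φ) ⇒ (η ⇒ ψ)))
    c3 : ∀ {L} φ ψ → L ⊢ (((¬′ φ) ⇒ (¬′ ψ)) ⇒ (((¬′ φ) ⇒ ψ) ⇒ φ))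
    m2 : ∀ {L} φ ψ → L ⊢ ((□ (φ ⇒ ψ)) ⇒ ((□ φ) ⇒ (□ ψ)))
    m3 : ∀ {L} φ → L ⊢ ((□ φ) ⇒ φ)
    b1 : ∀ {L} φ ψ → L ⊢ ((□ (φ ⇒ ψ)) ⇒ ((□ (¬′ φ)) ∨ (□ (ψ ∣ φ))))
    b2 : ∀ {L} φ ψ η → L ⊢ (((ψ ⇒ η) ∣ φ) ⇒ ((ψ ∣ φ) ⇒ (η ∣ φ)))
    b3 : ∀ {L} φ ψ → L ⊢ ((ψ ∣ φ) ⇒ (φ ⇒ ψ))
    b4 : ∀ {L} φ ψ → L ⊢ ((¬′ ((¬′ ψ) ∣ φ)) ⇔ (ψ ∣ φ))
    b5 : ∀ φ ψ → DmBL ⊢ ((ψ ⊗ φ) ⇔ (φ ⊗ ψ))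
    b5wA : ∀ φ ψ → DmBL* ⊢ ((ψ ⊗ (¬′ φ)) ⇔ (ψ ⊗ φ))
    b5wB : ∀ φ ψ η → DmBL* ⊢ ((□ (ψ ⇔ η)) ⇒ (□ ((φ ∣ ψ) ⇔ (φ ∣ η))))
    mp : ∀ {L φ ψ} → L ⊢ φ → L ⊢ (φ ⇒ ψ) → L ⊢ ψ
    m1 : ∀ {L φ} → L ⊢ φ → L ⊢ (□ φ)

  _⊢_≡′_ : Logic → Form Θ → Form Θ → Set a
  L ⊢ φ ≡′ ψ = L ⊢ (φ ⇔ ψ)

{-# OPTIONS --safe #-}
module Submission where

-- By b3 a conditional implies the material implication, so (ψ|φ) ∧ φ yields ψ.
-- Conversely, assume φ ∧ ψ and suppose (ψ|φ) fails: by b4 then (¬ψ|φ) holds,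
-- and b3 turns this into ¬ψ given φ, a contradiction.

open import Level using (Level)
open import Data.List using (List; []; _∷_)
open import Data.List.Membership.Propositional using (_∈_)
open import Data.List.Relation.Unary.Any using (here; there)
open import Relation.Binary.PropositionalEquality using (refl)
open import Defs

module Derivations {a : Level} {Θ : Set a} (θ₀ : Θ) (L : Logic) where
  open Abbrev θ₀
  open Proof θ₀

  infix 4 _⊩_

  data _⊩_ (Γ : List (Form Θ)) : Form Θ → Set a where
    theorem      : ∀ {A} → L ⊢ A → Γ ⊩ A
    assumption   : ∀ {A} → A ∈ Γ → Γ ⊩ A
    modus-ponens : ∀ {A B} → Γ ⊩ A → Γ ⊩ (A ⇒ B) → Γ ⊩ B

  close : ∀ {A} → [] ⊩ A → L ⊢ A
  close (theorem p)        = p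
  close (assumption ())
  close (modus-ponens p q) = mp (close p) (close q)

  ⇒-refl : ∀ A → L ⊢ (A ⇒ A)
  ⇒-refl A = mp (c1 A A) (mp (c1 A (A ⇒ A)) (c2 A (A ⇒ A) A))

  deduction : ∀ {Γ A B} → (A ∷ Γ) ⊩ B → Γ ⊩ (A ⇒ B)
  deduction {A = A} {B} (theorem p)               = theorem (mp p (c1 B A))
  deduction {A = A}     (assumption (here refl))  = theorem (⇒-refl A)
  deduction {A = A} {B} (assumption (there A∈Γ))  =
    modus-ponens (assumption A∈Γ) (theorem (c1 B A))
  deduction {A = A} {B} (modus-ponens {C} p q)    =
    modus-ponens (deduction p) (modus-ponens (deduction q) (theorem (c2 A C B)))

  weaken : ∀ {Γ A B} → Γ ⊩ A → (B ∷ Γ) ⊩ A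
  weaken (theorem p)        = theorem p
  weaken (assumption A∈Γ)   = assumption (there A∈Γ)
  weaken (modus-ponens p q) = modus-ponens (weaken p) (weaken q)

  latest : ∀ {Γ A} → (A ∷ Γ) ⊩ A
  latest = assumption (here refl)

  by-contradiction : ∀ {Γ A B} → (¬′ A ∷ Γ) ⊩ B → (¬′ A ∷ Γ) ⊩ ¬′ B → Γ ⊩ A
  by-contradiction {A = A} {B} p q =
    modus-ponens (deduction p) (modus-ponens (deduction q) (theorem (c3 A B)))

  explosion : ∀ {Γ A B} → Γ ⊩ B → Γ ⊩ ¬′ B → Γ ⊩ A
  explosion p q = by-contradiction (weaken p) (weaken q)

  ¬¬-elim : ∀ {Γ A} → Γ ⊩ ¬′ ¬′ A → Γ ⊩ A
  ¬¬-elim p = by-contradiction latest (weaken p)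

  ¬¬-intro : ∀ {Γ A} → Γ ⊩ A → Γ ⊩ ¬′ ¬′ A
  ¬¬-intro p = by-contradiction (weaken p) (¬¬-elim latest)

  ¬-intro : ∀ {Γ A B} → (A ∷ Γ) ⊩ B → (A ∷ Γ) ⊩ ¬′ B → Γ ⊩ ¬′ A
  ¬-intro p q = by-contradiction (modus-ponens (¬¬-elim latest) (weaken (deduction p)))
                                 (modus-ponens (¬¬-elim latest) (weaken (deduction q)))

  ∧-intro : ∀ {Γ A B} → Γ ⊩ A → Γ ⊩ B → Γ ⊩ (A ∧ B)
  ∧-intro p q = ¬-intro (weaken q) (modus-ponens (¬¬-intro (weaken p)) latest)

  ∧-proj₁ : ∀ {Γ A B} → Γ ⊩ (A ∧ B) → Γ ⊩ A
  ∧-proj₁ p = by-contradiction (deduction (explosion (weaken latest) latest)) (weaken p)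

  ∧-proj₂ : ∀ {Γ A B} → Γ ⊩ (A ∧ B) → Γ ⊩ B
  ∧-proj₂ p = by-contradiction (deduction (weaken latest)) (weaken p)

  ⇔-intro : ∀ {Γ A B} → (A ∷ Γ) ⊩ B → (B ∷ Γ) ⊩ A → Γ ⊩ (A ⇔ B)
  ⇔-intro p q = ∧-intro (deduction p) (deduction q)

  ⇔-to : ∀ {Γ A B} → Γ ⊩ (A ⇔ B) → Γ ⊩ A → Γ ⊩ B
  ⇔-to p q = modus-ponens q (∧-proj₁ p)

  conditional-elim : ∀ {Γ φ ψ} → Γ ⊩ (ψ ∣ φ) → Γ ⊩ φ → Γ ⊩ ψ
  conditional-elim {φ = φ} {ψ} p q = modus-ponens q (modus-ponens p (theorem (b3 φ ψ)))

  conditional-intro : ∀ {Γ φ ψ} → Γ ⊩ φ → Γ ⊩ ψ → Γ ⊩ (ψ ∣ φ)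
  conditional-intro {φ = φ} {ψ} p q = by-contradiction (weaken q) (conditional-elim ¬ψ∣φ (weaken p))
    where
      ¬ψ∣φ : ∀ {Γ} → (¬′ (ψ ∣ φ) ∷ Γ) ⊩ ((¬′ ψ) ∣ φ)
      ¬ψ∣φ = by-contradiction (⇔-to (theorem (b4 φ ψ)) latest) (weaken latest)

  conditional-∧-antecedent : ∀ φ ψ → [] ⊩ (((ψ ∣ φ) ∧ φ) ⇔ (φ ∧ ψ))
  conditional-∧-antecedent φ ψ =
    ⇔-intro (∧-intro (∧-proj₂ latest) (conditional-elim (∧-proj₁ latest) (∧-proj₂ latest)))
            (∧-intro (conditional-intro (∧-proj₁ latest) (∧-proj₂ latest)) (∧-proj₁ latest))

mainTheorem5 : {a : Level} {Θ : Set a} (θ₀ : Θ) (L : Logic) (φ ψ : Form Θ) →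
    Proof._⊢_≡′_ θ₀ L (Abbrev._∧_ θ₀ (ψ ∣ φ) φ) (Abbrev._∧_ θ₀ φ ψ)
mainTheorem5 θ₀ L φ ψ = close (conditional-∧-antecedent φ ψ)
  where open Derivations θ₀ L
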